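{- Let $G=(V,E)$ be a graph, let $C$ be a minimum vertex cover of $G$, and let $(L^C,X^C,R^C)$ be a partition of $C$ into three (possibly empty) parts. Then $(L^C,X^C,R^C)$ is the trace on $C$ of some node of some tree decomposition of $G$ (equivalently, of some node of some path decomposition of $G$) if and only if $X^C$ separates $L^C$ from $R^C$ in $G[C]$, i.e. every path in $G[C]$ from a vertex of $L^C$ to a vertex of $R^C$ contains a vertex of $X^C$.
   Context: A tree decomposition of $G$ is a pair $(T,\{X_i\}_{i\in I})$ with $T$ a tree and $X_i\subseteq V$ (bags) such that every vertex lies in some bag, every edge has both endpoints in some bag, and for each vertex $v$ the nodes whose bags contain $v$ induce a connected subtree of $T$. A path decomposition is a tree decomposition whose tree is a path. Root $T$ arbitrarily. For a node $i$, let $T_i$ be the subtree rooted at $i$, $V_i$ the union of the bags of $T_i$, $L_i=V_i\setminus X_i$ and $R_i=V\setminus V_i$, so $(L_i,X_i,R_i)$ partitions $V$. The trace of node $i$ on $C$ is the triple $(L_i\cap C, X_i\cap C, R_i\cap C)$. -}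

module Defs where

open import Level using (0ℓ)
open import Data.Nat using (ℕ; suc; _≤_)
open import Data.Fin using (Fin; toℕ)
open import Data.Fin.Subset using (Subset; _∈_; _∉_; ∣_∣)
open import Data.List using (List; []; _∷_)
open import Data.List.Relation.Unary.All using (All)
open import Data.List.Relation.Unary.Any using (Any)
open import Data.List.Relation.Unary.Unique.Propositional using (Unique)
open import Data.Product using (Σ; ∃; ∃-syntax; _×_)
open import Data.Sum using (_⊎_)
open import Relation.Nullary using (¬_)
open import Relation.Binary.PropositionalEquality using (_≡_)
open import Function.Bundles using (_⇔_)

record Graph (n : ℕ) : Set₁ where
  field
    Adj    : Fin n → Fin n → Set
    sym    : ∀ {u v} → Adj u v → Adj v u
    irrefl : ∀ {u} → ¬ Adj u u
open Graph public

data Walk {n : ℕ} (G : Graph n) : Fin n → Fin n → Set where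
  []  : ∀ {u} → Walk G u u
  _∷_ : ∀ {u v w} → Adj G u v → Walk G v w → Walk G u w

verts : ∀ {n} {G : Graph n} {u v} → Walk G u v → List (Fin n)
verts {u = u} []      = u ∷ []
verts {u = u} (e ∷ p) = u ∷ verts p

IsPath : ∀ {n} {G : Graph n} {u v} → Walk G u v → Set
IsPath p = Unique (verts p)

IsTree : ∀ {m} → Graph m → Set
IsTree T = (∀ i j → Σ (Walk T i j) IsPath)
         × (∀ i j (p q : Walk T i j) → IsPath p → IsPath q → verts p ≡ verts q)

IsPathGraph : ∀ {m} → Graph m → Set
IsPathGraph {m} T = ∀ i j → Adj T i j ⇔ ((suc (toℕ i) ≡ toℕ j) ⊎ (suc (toℕ j) ≡ toℕ i))

IsVertexCover : ∀ {n} → Graph n → Subset n → Set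
IsVertexCover G C = ∀ u v → Adj G u v → u ∈ C ⊎ v ∈ C

IsMinimumVertexCover : ∀ {n} → Graph n → Subset n → Set
IsMinimumVertexCover G C =
  IsVertexCover G C × (∀ C' → IsVertexCover G C' → ∣ C ∣ ≤ ∣ C' ∣)

IsPartition3 : ∀ {n} → Subset n → Subset n → Subset n → Subset n → Set
IsPartition3 C L X R =
  (∀ v → v ∈ C ⇔ ((v ∈ L ⊎ v ∈ X) ⊎ v ∈ R))
  × (∀ v → v ∈ L → v ∉ X) × (∀ v → v ∈ L → v ∉ R) × (∀ v → v ∈ X → v ∉ R)

record TreeDecomposition {n : ℕ} (G : Graph n) : Set₁ where
  field
    m      : ℕ
    T      : Graph m
    isTree : IsTree T
    root   : Fin m
    bag    : Fin m → Subset n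
    vertex-covered : ∀ v → ∃[ i ] v ∈ bag i
    edge-covered   : ∀ u v → Adj G u v → ∃[ i ] (u ∈ bag i × v ∈ bag i)
    connected      : ∀ v i j → v ∈ bag i → v ∈ bag j →
                     Σ (Walk T i j) (λ p → All (λ k → v ∈ bag k) (verts p))

  -- j lies in the subtree T_i rooted at i: every walk from j to the root passes i.
  InSubtree : Fin m → Fin m → Set
  InSubtree i j = ∀ (p : Walk T j root) → Any (i ≡_) (verts p)

  Vsub : Fin m → Fin n → Set
  Vsub i v = ∃[ j ] (InSubtree i j × v ∈ bag j)

  Lpart : Fin m → Fin n → Set
  Lpart i v = Vsub i v × v ∉ bag i

  Xpart : Fin m → Fin n → Set
  Xpart i v = v ∈ bag i

  Rpart : Fin m → Fin n → Set
  Rpart i v = ¬ Vsub i v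
open TreeDecomposition public

IsPathDecomposition : ∀ {n} {G : Graph n} → TreeDecomposition G → Set
IsPathDecomposition D = IsPathGraph (T D)

TraceIs : ∀ {n} {G : Graph n} (D : TreeDecomposition G) → Fin (m D) →
          Subset n → Subset n → Subset n → Subset n → Set
TraceIs D i C L X R =
  (∀ v → v ∈ L ⇔ (v ∈ C × Lpart D i v))
  × (∀ v → v ∈ X ⇔ (v ∈ C × Xpart D i v))
  × (∀ v → v ∈ R ⇔ (v ∈ C × Rpart D i v))

IsTraceOfTD : ∀ {n} → Graph n → Subset n → Subset n → Subset n → Subset n → Set₁
IsTraceOfTD G C L X R = Σ (TreeDecomposition G) λ D → ∃[ i ] TraceIs D i C L X R

IsTraceOfPD : ∀ {n} → Graph n → Subset n → Subset n → Subset n → Subset n → Set₁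
IsTraceOfPD G C L X R =
  Σ (TreeDecomposition G) λ D → IsPathDecomposition D × ∃[ i ] TraceIs D i C L X R

SeparatesIn : ∀ {n} → Graph n → Subset n → Subset n → Subset n → Subset n → Set
SeparatesIn G C L X R =
  ∀ u v → u ∈ L → v ∈ R → (p : Walk G u v) → IsPath p →
  All (_∈ C) (verts p) → Any (_∈ X) (verts p)

-- If (L , X , R) is the trace of node i, then X_i separates V_i \ X_i from the rest of G: an
-- edge leaving V_i from outside X_i would put a subtree vertex into a bag outside the subtree
-- without passing through i. Restricting to C gives the separation in G[C]. Conversely, when X
-- separates L from R in G[C] there is no edge between L and R, so the three bags
-- L ∪ Y, Y, R ∪ Y with Y = X ∪ (V \ C), strung along a path and rooted at the last one, form a
-- path decomposition whose middle node has trace (L , X , R).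
module Submission where

open import Defs
open import Data.Nat using (suc)
open import Data.Nat.Properties using (1+n≢n)
open import Data.Fin using (Fin; toℕ)
open import Data.Fin.Patterns using (0F; 1F; 2F)
open import Data.Fin.Subset using (Subset; _∈_; _∉_; _∪_; ∁)
open import Data.Fin.Subset.Properties using (_∈?_; x∈p∪q⁻; p⊆p∪q; q⊆p∪q; x∈∁p⇒x∉p; x∉p⇒x∈∁p)
open import Data.List using (List; []; _∷_)
open import Data.List.Relation.Unary.All as All using (All; []; _∷_)
open import Data.List.Relation.Unary.Any using (Any; here; there)
open import Data.List.Relation.Unary.AllPairs using ([]; _∷_)
open import Data.Product using (Σ; ∃-syntax; _×_; _,_; proj₁; proj₂)
open import Data.Sum using (_⊎_; inj₁; inj₂; swap)
open import Data.Empty using (⊥; ⊥-elim)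
open import Relation.Nullary using (¬_; yes; no)
open import Relation.Binary.PropositionalEquality
  using (_≡_; _≢_; refl; cong; trans; subst) renaming (sym to ≡-sym)
open import Function using (id)
open import Function.Bundles using (_⇔_; mk⇔; Equivalence)

open Equivalence

module _ {n} {G : Graph n} where

  _++ʷ_ : ∀ {a b c} → Walk G a b → Walk G b c → Walk G a c
  []      ++ʷ q = q
  (e ∷ p) ++ʷ q = e ∷ (p ++ʷ q)

  Any-++ʷ⁻ : ∀ {a b c} {P : Fin n → Set} (p : Walk G a b) (q : Walk G b c) →
             Any P (verts (p ++ʷ q)) → Any P (verts p) ⊎ Any P (verts q)
  Any-++ʷ⁻ []      q h         = inj₂ h
  Any-++ʷ⁻ (e ∷ p) q (here h)  = inj₁ (here h)
  Any-++ʷ⁻ (e ∷ p) q (there h) with Any-++ʷ⁻ p q h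
  ... | inj₁ h′ = inj₁ (there h′)
  ... | inj₂ h′ = inj₂ h′

  edge-isPath : ∀ {a b} (e : Adj G a b) → IsPath {G = G} (e ∷ [])
  edge-isPath e = ((λ { refl → irrefl G e }) ∷ []) ∷ [] ∷ []

  start∈verts : ∀ {a b} (p : Walk G a b) → Any (a ≡_) (verts p)
  start∈verts []      = here refl
  start∈verts (e ∷ p) = here refl

Any-mapWithAll : ∀ {A : Set} {P Q R : A → Set} {xs} →
               (∀ {x} → P x → Q x → R x) → All P xs → Any Q xs → Any R xs
Any-mapWithAll f (px ∷ _)  (here qx)  = here (f px qx)
Any-mapWithAll f (_ ∷ pxs) (there qs) = there (Any-mapWithAll f pxs qs)

module _ {n} {G : Graph n} (D : TreeDecomposition G) (i : Fin (m D)) where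

  Vsub-step : ∀ {a b} → Adj G a b → Vsub D i a → a ∉ bag D i → Vsub D i b
  Vsub-step {a} {b} e (j , j≤i , a∈j) a∉i with edge-covered D a b e
  ... | k , a∈k , b∈k = k , k≤i , b∈k
    where
    j→k = connected D a j k a∈j a∈k
    -- j→k stays in bags containing a, so misses i; hence every walk from k to the root meets i.
    k≤i : InSubtree D i k
    k≤i q with Any-++ʷ⁻ (proj₁ j→k) q (j≤i (proj₁ j→k ++ʷ q))
    ... | inj₁ i∈j→k = ⊥-elim (a∉i (All.lookup (proj₂ j→k) i∈j→k))
    ... | inj₂ i∈q   = i∈q

  walk-out-of-Vsub-meets-bag : ∀ {u v} (p : Walk G u v) → Vsub D i u → ¬ Vsub D i v →
                               Any (_∈ bag D i) (verts p)
  walk-out-of-Vsub-meets-bag []      u∈V v∉V = ⊥-elim (v∉V u∈V)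
  walk-out-of-Vsub-meets-bag {u} (e ∷ p) u∈V v∉V with u ∈? bag D i
  ... | yes u∈i = here u∈i
  ... | no u∉i  = there (walk-out-of-Vsub-meets-bag p (Vsub-step e u∈V u∉i) v∉V)

trace⇒separates : ∀ {n} {G : Graph n} {C L X R : Subset n} (D : TreeDecomposition G) (i : Fin (m D)) →
                  TraceIs D i C L X R → SeparatesIn G C L X R
trace⇒separates D i (L⇔ , X⇔ , R⇔) u v u∈L v∈R p _ p⊆C =
  Any-mapWithAll (λ {x} x∈C x∈i → from (X⇔ x) (x∈C , x∈i)) p⊆C
    (walk-out-of-Vsub-meets-bag D i p (proj₁ (proj₂ (to (L⇔ u) u∈L)))
                                      (proj₂ (to (R⇔ v) v∈R)))

pathGraph : ∀ m → Graph m
pathGraph m = record { Adj = Consecutive ; sym = swap ; irrefl = irreflexive }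
  where
  Consecutive : Fin m → Fin m → Set
  Consecutive i j = (suc (toℕ i) ≡ toℕ j) ⊎ (suc (toℕ j) ≡ toℕ i)
  irreflexive : ∀ {i} → ¬ Consecutive i i
  irreflexive (inj₁ e) = 1+n≢n e
  irreflexive (inj₂ e) = 1+n≢n e

pathGraph-isPathGraph : ∀ m → IsPathGraph (pathGraph m)
pathGraph-isPathGraph m i j = mk⇔ id id

P₃ : Graph 3
P₃ = pathGraph 3

P₃-path : ∀ i j → Σ (Walk P₃ i j) IsPath
P₃-path 0F 0F = [] , [] ∷ []
P₃-path 0F 1F = inj₁ refl ∷ [] , edge-isPath {G = P₃} (inj₁ refl)
P₃-path 0F 2F = inj₁ refl ∷ inj₁ refl ∷ [] , ((λ ()) ∷ (λ ()) ∷ []) ∷ ((λ ()) ∷ []) ∷ [] ∷ []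
P₃-path 1F 0F = inj₂ refl ∷ [] , edge-isPath {G = P₃} (inj₂ refl)
P₃-path 1F 1F = [] , [] ∷ []
P₃-path 1F 2F = inj₁ refl ∷ [] , edge-isPath {G = P₃} (inj₁ refl)
P₃-path 2F 0F = inj₂ refl ∷ inj₂ refl ∷ [] , ((λ ()) ∷ (λ ()) ∷ []) ∷ ((λ ()) ∷ []) ∷ [] ∷ []
P₃-path 2F 1F = inj₂ refl ∷ [] , edge-isPath {G = P₃} (inj₂ refl)
P₃-path 2F 2F = [] , [] ∷ []

P₃-route : Fin 3 → Fin 3 → List (Fin 3)
P₃-route i j = verts (proj₁ (P₃-path i j))

P₃-route-step : ∀ i k j → Adj P₃ i k → All (i ≢_) (P₃-route k j) → i ∷ P₃-route k j ≡ P₃-route i j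
P₃-route-step 0F 0F _  (inj₁ ()) _
P₃-route-step 0F 0F _  (inj₂ ()) _
P₃-route-step 0F 1F 0F _ (_ ∷ 0≢0 ∷ _) = ⊥-elim (0≢0 refl)
P₃-route-step 0F 1F 1F _ _ = refl
P₃-route-step 0F 1F 2F _ _ = refl
P₃-route-step 0F 2F _  (inj₁ ()) _
P₃-route-step 0F 2F _  (inj₂ ()) _
P₃-route-step 1F 0F 0F _ _ = refl
P₃-route-step 1F 0F 1F _ (_ ∷ 1≢1 ∷ _) = ⊥-elim (1≢1 refl)
P₃-route-step 1F 0F 2F _ (_ ∷ 1≢1 ∷ _) = ⊥-elim (1≢1 refl)
P₃-route-step 1F 1F _  (inj₁ ()) _
P₃-route-step 1F 1F _  (inj₂ ()) _
P₃-route-step 1F 2F 0F _ (_ ∷ 1≢1 ∷ _) = ⊥-elim (1≢1 refl)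
P₃-route-step 1F 2F 1F _ (_ ∷ 1≢1 ∷ _) = ⊥-elim (1≢1 refl)
P₃-route-step 1F 2F 2F _ _ = refl
P₃-route-step 2F 0F _  (inj₁ ()) _
P₃-route-step 2F 0F _  (inj₂ ()) _
P₃-route-step 2F 1F 0F _ _ = refl
P₃-route-step 2F 1F 1F _ _ = refl
P₃-route-step 2F 1F 2F _ (_ ∷ 2≢2 ∷ _) = ⊥-elim (2≢2 refl)
P₃-route-step 2F 2F _  (inj₁ ()) _
P₃-route-step 2F 2F _  (inj₂ ()) _

P₃-path-unique : ∀ {i j} (p : Walk P₃ i j) → IsPath p → verts p ≡ P₃-route i j
P₃-path-unique {0F} [] _ = refl
P₃-path-unique {1F} [] _ = refl
P₃-path-unique {2F} [] _ = refl
P₃-path-unique {i} {j} (_∷_ {v = k} e p) (i∉p ∷ p-path) =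
  trans (cong (i ∷_) p≡route) (P₃-route-step i k j e (subst (All (i ≢_)) p≡route i∉p))
  where p≡route = P₃-path-unique p p-path

P₃-isTree : IsTree P₃
P₃-isTree = P₃-path , λ i j p q p-path q-path →
  trans (P₃-path-unique p p-path) (≡-sym (P₃-path-unique q q-path))

module ThreeBags {n} (G : Graph n) (A Y B : Subset n)
                 (covers : ∀ v → v ∈ A ⊎ v ∈ Y ⊎ v ∈ B)
                 (A∩B≡∅ : ∀ {v} → v ∈ A → v ∉ B)
                 (no-A–B-edge : ∀ {u v} → Adj G u v → u ∈ A → v ∈ B → ⊥) where

  bags : Fin 3 → Subset n
  bags 0F = A ∪ Y
  bags 1F = Y
  bags 2F = B ∪ Y

  Y⊆bags : ∀ k {v} → v ∈ Y → v ∈ bags k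
  Y⊆bags 0F = q⊆p∪q A Y
  Y⊆bags 1F = id
  Y⊆bags 2F = q⊆p∪q B Y

  bags-cover-vertices : ∀ v → ∃[ k ] v ∈ bags k
  bags-cover-vertices v with covers v
  ... | inj₁ v∈A        = 0F , p⊆p∪q Y v∈A
  ... | inj₂ (inj₁ v∈Y) = 1F , v∈Y
  ... | inj₂ (inj₂ v∈B) = 2F , p⊆p∪q Y v∈B

  bags-cover-edges : ∀ u v → Adj G u v → ∃[ k ] (u ∈ bags k × v ∈ bags k)
  bags-cover-edges u v e with covers u | covers v
  ... | inj₂ (inj₁ u∈Y) | _ = let k , v∈k = bags-cover-vertices v in k , Y⊆bags k u∈Y , v∈k
  ... | inj₁ u∈A | inj₁ v∈A        = 0F , p⊆p∪q Y u∈A , p⊆p∪q Y v∈A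
  ... | inj₁ u∈A | inj₂ (inj₁ v∈Y) = 0F , p⊆p∪q Y u∈A , q⊆p∪q A Y v∈Y
  ... | inj₁ u∈A | inj₂ (inj₂ v∈B) = ⊥-elim (no-A–B-edge e u∈A v∈B)
  ... | inj₂ (inj₂ u∈B) | inj₁ v∈A        = ⊥-elim (no-A–B-edge (sym G e) v∈A u∈B)
  ... | inj₂ (inj₂ u∈B) | inj₂ (inj₁ v∈Y) = 2F , p⊆p∪q Y u∈B , q⊆p∪q B Y v∈Y
  ... | inj₂ (inj₂ u∈B) | inj₂ (inj₂ v∈B) = 2F , p⊆p∪q Y u∈B , p⊆p∪q Y v∈B

  bags-outer⇒middle : ∀ {v} → v ∈ bags 0F → v ∈ bags 2F → v ∈ bags 1F
  bags-outer⇒middle {v} v∈0 v∈2 with x∈p∪q⁻ A Y v∈0 | x∈p∪q⁻ B Y v∈2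
  ... | inj₂ v∈Y | _        = v∈Y
  ... | inj₁ _   | inj₂ v∈Y = v∈Y
  ... | inj₁ v∈A | inj₁ v∈B = ⊥-elim (A∩B≡∅ v∈A v∈B)

  bags-connected : ∀ v i j → v ∈ bags i → v ∈ bags j →
                   Σ (Walk P₃ i j) (λ p → All (λ k → v ∈ bags k) (verts p))
  bags-connected v i j v∈i v∈j = proj₁ (P₃-path i j) , along i j v∈i v∈j
    where
    along : ∀ i j → v ∈ bags i → v ∈ bags j → All (λ k → v ∈ bags k) (P₃-route i j)
    along 0F 0F v∈i _   = v∈i ∷ []
    along 0F 1F v∈i v∈j = v∈i ∷ v∈j ∷ []
    along 0F 2F v∈i v∈j = v∈i ∷ bags-outer⇒middle v∈i v∈j ∷ v∈j ∷ []
    along 1F 0F v∈i v∈j = v∈i ∷ v∈j ∷ []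
    along 1F 1F v∈i _   = v∈i ∷ []
    along 1F 2F v∈i v∈j = v∈i ∷ v∈j ∷ []
    along 2F 0F v∈i v∈j = v∈i ∷ bags-outer⇒middle v∈j v∈i ∷ v∈j ∷ []
    along 2F 1F v∈i v∈j = v∈i ∷ v∈j ∷ []
    along 2F 2F v∈i _   = v∈i ∷ []

  decomposition : TreeDecomposition G
  decomposition = record
    { m = 3 ; T = P₃ ; isTree = P₃-isTree ; root = 2F ; bag = bags
    ; vertex-covered = bags-cover-vertices ; edge-covered = bags-cover-edges
    ; connected = bags-connected }

  decomposition-isPath : IsPathDecomposition decomposition
  decomposition-isPath = pathGraph-isPathGraph 3

  Vsub-middle⇔ : ∀ v → Vsub decomposition 1F v ⇔ (v ∈ A ⊎ v ∈ Y)
  Vsub-middle⇔ v = mk⇔ below below⁻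
    where
    0≤1 : InSubtree decomposition 1F 0F
    0≤1 (_∷_ {v = 0F} (inj₁ ()) _)
    0≤1 (_∷_ {v = 0F} (inj₂ ()) _)
    0≤1 (_∷_ {v = 1F} _ p)        = there (start∈verts p)
    0≤1 (_∷_ {v = 2F} (inj₁ ()) _)
    0≤1 (_∷_ {v = 2F} (inj₂ ()) _)

    2≰1 : ¬ InSubtree decomposition 1F 2F
    2≰1 2≤1 with 2≤1 []
    ... | here ()
    ... | there ()

    below : Vsub decomposition 1F v → v ∈ A ⊎ v ∈ Y
    below (0F , _ , v∈0)   = x∈p∪q⁻ A Y v∈0
    below (1F , _ , v∈Y)   = inj₂ v∈Y
    below (2F , 2≤1 , _) = ⊥-elim (2≰1 2≤1)

    below⁻ : v ∈ A ⊎ v ∈ Y → Vsub decomposition 1F v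
    below⁻ (inj₁ v∈A) = 0F , 0≤1 , p⊆p∪q Y v∈A
    below⁻ (inj₂ v∈Y) = 1F , start∈verts , v∈Y

module _ {n} {G : Graph n} {C L X R : Subset n} (part : IsPartition3 C L X R) where

  private
    C⇔ = proj₁ part
    L∩X≡∅ = proj₁ (proj₂ part)
    L∩R≡∅ = proj₁ (proj₂ (proj₂ part))
    X∩R≡∅ = proj₂ (proj₂ (proj₂ part))

    L⊆C : ∀ {v} → v ∈ L → v ∈ C
    L⊆C {v} v∈L = from (C⇔ v) (inj₁ (inj₁ v∈L))

    X⊆C : ∀ {v} → v ∈ X → v ∈ C
    X⊆C {v} v∈X = from (C⇔ v) (inj₁ (inj₂ v∈X))

    R⊆C : ∀ {v} → v ∈ R → v ∈ C
    R⊆C {v} v∈R = from (C⇔ v) (inj₂ v∈R)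

  separates⇒no-L–R-edge : SeparatesIn G C L X R → ∀ {u v} → Adj G u v → u ∈ L → v ∈ R → ⊥
  separates⇒no-L–R-edge sep {u} {v} e u∈L v∈R
    with sep u v u∈L v∈R (e ∷ []) (edge-isPath {G = G} e) (L⊆C u∈L ∷ R⊆C v∈R ∷ [])
  ... | here u∈X         = L∩X≡∅ u u∈L u∈X
  ... | there (here v∈X) = X∩R≡∅ v v∈X v∈R

  separates⇒pathTrace : SeparatesIn G C L X R →
                        Σ (TreeDecomposition G) λ D → IsPathDecomposition D × ∃[ i ] TraceIs D i C L X R
  separates⇒pathTrace sep = decomposition , decomposition-isPath , 1F , L-trace , X-trace , R-trace
    where
    Y = X ∪ ∁ C

    Y∩C⊆X : ∀ {v} → v ∈ Y → v ∈ C → v ∈ X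
    Y∩C⊆X {v} v∈Y v∈C with x∈p∪q⁻ X (∁ C) v∈Y
    ... | inj₁ v∈X  = v∈X
    ... | inj₂ v∉C = ⊥-elim (x∈∁p⇒x∉p v∉C v∈C)

    covers : ∀ v → v ∈ L ⊎ v ∈ Y ⊎ v ∈ R
    covers v with v ∈? C
    ... | no v∉C = inj₂ (inj₁ (q⊆p∪q X (∁ C) (x∉p⇒x∈∁p v∉C)))
    ... | yes v∈C with to (C⇔ v) v∈C
    ...   | inj₁ (inj₁ v∈L) = inj₁ v∈L
    ...   | inj₁ (inj₂ v∈X) = inj₂ (inj₁ (p⊆p∪q (∁ C) v∈X))
    ...   | inj₂ v∈R        = inj₂ (inj₂ v∈R)

    open ThreeBags G L Y R covers (L∩R≡∅ _) (separates⇒no-L–R-edge sep)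

    L-trace : ∀ v → v ∈ L ⇔ (v ∈ C × Lpart decomposition 1F v)
    L-trace v = mk⇔ (λ v∈L → L⊆C v∈L , from (Vsub-middle⇔ v) (inj₁ v∈L)
                                     , λ v∈Y → L∩X≡∅ v v∈L (Y∩C⊆X v∈Y (L⊆C v∈L)))
                    λ { (_ , v∈V , v∉Y) → case-L (to (Vsub-middle⇔ v) v∈V) v∉Y }
      where
      case-L : v ∈ L ⊎ v ∈ Y → v ∉ Y → v ∈ L
      case-L (inj₁ v∈L) _   = v∈L
      case-L (inj₂ v∈Y) v∉Y = ⊥-elim (v∉Y v∈Y)

    X-trace : ∀ v → v ∈ X ⇔ (v ∈ C × Xpart decomposition 1F v)
    X-trace v = mk⇔ (λ v∈X → X⊆C v∈X , p⊆p∪q (∁ C) v∈X) λ { (v∈C , v∈Y) → Y∩C⊆X v∈Y v∈C }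

    R-trace : ∀ v → v ∈ R ⇔ (v ∈ C × Rpart decomposition 1F v)
    R-trace v = mk⇔ (λ v∈R → R⊆C v∈R , λ v∈V → not-below v∈R (to (Vsub-middle⇔ v) v∈V))
                    λ { (v∈C , v∉V) → case-R v∉V (to (C⇔ v) v∈C) }
      where
      not-below : v ∈ R → ¬ (v ∈ L ⊎ v ∈ Y)
      not-below v∈R (inj₁ v∈L) = L∩R≡∅ v v∈L v∈R
      not-below v∈R (inj₂ v∈Y) = X∩R≡∅ v (Y∩C⊆X v∈Y (R⊆C v∈R)) v∈R

      case-R : ¬ Vsub decomposition 1F v → (v ∈ L ⊎ v ∈ X) ⊎ v ∈ R → v ∈ R
      case-R v∉V (inj₁ (inj₁ v∈L)) = ⊥-elim (v∉V (from (Vsub-middle⇔ v) (inj₁ v∈L)))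
      case-R v∉V (inj₁ (inj₂ v∈X)) = ⊥-elim (v∉V (from (Vsub-middle⇔ v) (inj₂ (p⊆p∪q (∁ C) v∈X))))
      case-R _   (inj₂ v∈R)        = v∈R

lemma1 : ∀ {n} (G : Graph n) (C L X R : Subset n) →
         IsMinimumVertexCover G C → IsPartition3 C L X R →
         (IsTraceOfTD G C L X R ⇔ SeparatesIn G C L X R)
         × (IsTraceOfPD G C L X R ⇔ SeparatesIn G C L X R)
lemma1 G C L X R _ part =
  mk⇔ (λ { (D , i , tr) → trace⇒separates D i tr })
      (λ sep → let D , _ , i,tr = separates⇒pathTrace part sep in D , i,tr)
  , mk⇔ (λ { (D , _ , i , tr) → trace⇒separates D i tr })
        (separates⇒pathTrace part)
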